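{- The logic $\mathbf{GL}\otimes\mathbf{Triv}$ is a conservative extension of $\mathbf{GL}$: for every $\mathcal L_{\mathsf p}$-formula $A$, $\mathbf{GL}\otimes\mathbf{Triv}\vdash A$ iff $\mathbf{GL}\vdash A$.
   Context: $\mathcal L_{\mathsf p}$ is the unimodal propositional language with modal operator $\Box_{\mathsf p}$; $\mathcal L_{\mathsf{pf}}$ extends it with a second modal operator $\Box_{\mathsf f}$. $\mathbf{GL}$ (in $\mathcal L_{\mathsf p}$) has axioms: propositional tautologies, $\Box_{\mathsf p}(A\to B)\to(\Box_{\mathsf p}A\to\Box_{\mathsf p}B)$, $\Box_{\mathsf p}(\Box_{\mathsf p}A\to A)\to\Box_{\mathsf p}A$; rules modus ponens and $\Box_{\mathsf p}$-necessitation. $\mathbf{GL}\otimes\mathbf{Triv}$ (in $\mathcal L_{\mathsf{pf}}$) has axioms: all propositional tautologies of $\mathcal L_{\mathsf{pf}}$, all instances (in $\mathcal L_{\mathsf{pf}}$) of the $\mathbf{GL}$ axioms, and $A\leftrightarrow\Box_{\mathsf f}A$; rules modus ponens and necessitation for $\Box_{\mathsf p}$. -}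

module Defs where

open import Data.Nat using (ℕ)
open import Data.Bool using (Bool; true; false; not; _∧_; _∨_)

data FmP : Set where
  varP : ℕ → FmP
  ⊥P   : FmP
  _⇒P_ : FmP → FmP → FmP
  □P   : FmP → FmP

infixr 5 _⇒P_

data Fm : Set where
  var  : ℕ → Fm
  ⊥'   : Fm
  _⇒_  : Fm → Fm → Fm
  □p   : Fm → Fm
  □f   : Fm → Fm

infixr 5 _⇒_

¬' : Fm → Fm
¬' A = A ⇒ ⊥'

_∧'_ : Fm → Fm → Fm
A ∧' B = ¬' (A ⇒ ¬' B)

_⇔_ : Fm → Fm → Fm
A ⇔ B = (A ⇒ B) ∧' (B ⇒ A)

emb : FmP → Fm
emb (varP n) = var n
emb ⊥P = ⊥'
emb (A ⇒P B) = emb A ⇒ emb B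
emb (□P A) = □p (emb A)

-- Propositional tautologies: true under every Boolean assignment to the
-- propositional atoms, where variables and modalised formulas count as atoms.
evalP : (ℕ → Bool) → (FmP → Bool) → FmP → Bool
evalP v w (varP n) = v n
evalP v w ⊥P = false
evalP v w (A ⇒P B) = not (evalP v w A) ∨ evalP v w B
evalP v w (□P A) = w A

TautP : FmP → Set
TautP A = (v : ℕ → Bool) (w : FmP → Bool) → evalP v w A ≡ true
  where open import Relation.Binary.PropositionalEquality using (_≡_)

evalF : (ℕ → Bool) → (Fm → Bool) → (Fm → Bool) → Fm → Bool
evalF v wp wf (var n) = v n
evalF v wp wf ⊥' = false
evalF v wp wf (A ⇒ B) = not (evalF v wp wf A) ∨ evalF v wp wf B
evalF v wp wf (□p A) = wp A
evalF v wp wf (□f A) = wf A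

Taut : Fm → Set
Taut A = (v : ℕ → Bool) (wp wf : Fm → Bool) → evalF v wp wf A ≡ true
  where open import Relation.Binary.PropositionalEquality using (_≡_)

data GL⊢_ : FmP → Set where
  taut : ∀ {A} → TautP A → GL⊢ A
  axK  : ∀ {A B} → GL⊢ (□P (A ⇒P B) ⇒P (□P A ⇒P □P B))
  axL  : ∀ {A} → GL⊢ (□P (□P A ⇒P A) ⇒P □P A)
  mp   : ∀ {A B} → GL⊢ (A ⇒P B) → GL⊢ A → GL⊢ B
  nec  : ∀ {A} → GL⊢ A → GL⊢ □P A

data GLTriv⊢_ : Fm → Set where
  taut   : ∀ {A} → Taut A → GLTriv⊢ A
  axK    : ∀ {A B} → GLTriv⊢ (□p (A ⇒ B) ⇒ (□p A ⇒ □p B))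
  axL    : ∀ {A} → GLTriv⊢ (□p (□p A ⇒ A) ⇒ □p A)
  axTriv : ∀ {A} → GLTriv⊢ (A ⇔ □f A)
  mp     : ∀ {A B} → GLTriv⊢ (A ⇒ B) → GLTriv⊢ A → GLTriv⊢ B
  nec    : ∀ {A} → GLTriv⊢ A → GLTriv⊢ □p A

{-# OPTIONS --safe #-}
module Submission where

-- Erasing □f translates L_pf into L_p, fixes embedded L_p-formulas, preserves
-- tautologies and the GL axioms and rules, and turns each A ↔ □f A into a tautology
-- of the form A' ↔ A'; so it maps GL ⊗ Triv-proofs to GL-proofs.  Conversely the
-- embedding maps GL-proofs to GL ⊗ Triv-proofs axiom by axiom.

open import Defs
open import Data.Product using (_×_; _,_)
open import Data.Bool using (true; false; not; _∨_)
open import Relation.Binary.PropositionalEquality using (_≡_; refl; sym; trans; cong; cong₂; subst)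

erase : Fm → FmP
erase (var n) = varP n
erase ⊥' = ⊥P
erase (A ⇒ B) = erase A ⇒P erase B
erase (□p A) = □P (erase A)
erase (□f A) = erase A

erase-emb : ∀ A → erase (emb A) ≡ A
erase-emb (varP n) = refl
erase-emb ⊥P = refl
erase-emb (A ⇒P B) = cong₂ _⇒P_ (erase-emb A) (erase-emb B)
erase-emb (□P A) = cong □P (erase-emb A)

-- A valuation of L_p induces one of L_pf: □p B gets the value of the atom □P (erase B),
-- and □f B the value of erase B itself.
evalF-erase : ∀ v w B →
  evalF v (λ C → w (erase C)) (λ C → evalP v w (erase C)) B ≡ evalP v w (erase B)
evalF-erase v w (var n) = refl
evalF-erase v w ⊥' = refl
evalF-erase v w (A ⇒ B) = cong₂ (λ a b → not a ∨ b) (evalF-erase v w A) (evalF-erase v w B)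
evalF-erase v w (□p A) = refl
evalF-erase v w (□f A) = refl

evalF-emb : ∀ v wp wf A → evalF v wp wf (emb A) ≡ evalP v (λ C → wp (emb C)) A
evalF-emb v wp wf (varP n) = refl
evalF-emb v wp wf ⊥P = refl
evalF-emb v wp wf (A ⇒P B) = cong₂ (λ a b → not a ∨ b) (evalF-emb v wp wf A) (evalF-emb v wp wf B)
evalF-emb v wp wf (□P A) = refl

erase-preserves-Taut : ∀ {B} → Taut B → TautP (erase B)
erase-preserves-Taut {B} h v w = trans (sym (evalF-erase v w B)) (h v _ _)

emb-preserves-TautP : ∀ {A} → TautP A → Taut (emb A)
emb-preserves-TautP {A} h v wp wf = trans (evalF-emb v wp wf A) (h v _)

erase-⇔-self : ∀ A → TautP (erase (A ⇔ □f A))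
erase-⇔-self A v w with evalP v w (erase A)
... | true = refl
... | false = refl

GLTriv⊢⇒GL⊢erase : ∀ {B} → GLTriv⊢ B → GL⊢ erase B
GLTriv⊢⇒GL⊢erase {B} (taut h) = taut (erase-preserves-Taut {B} h)
GLTriv⊢⇒GL⊢erase axK = axK
GLTriv⊢⇒GL⊢erase axL = axL
GLTriv⊢⇒GL⊢erase (axTriv {A}) = taut (erase-⇔-self A)
GLTriv⊢⇒GL⊢erase (mp p q) = mp (GLTriv⊢⇒GL⊢erase p) (GLTriv⊢⇒GL⊢erase q)
GLTriv⊢⇒GL⊢erase (nec p) = nec (GLTriv⊢⇒GL⊢erase p)

GL⊢⇒GLTriv⊢emb : ∀ {A} → GL⊢ A → GLTriv⊢ emb A
GL⊢⇒GLTriv⊢emb {A} (taut h) = taut (emb-preserves-TautP {A} h)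
GL⊢⇒GLTriv⊢emb axK = axK
GL⊢⇒GLTriv⊢emb axL = axL
GL⊢⇒GLTriv⊢emb (mp p q) = mp (GL⊢⇒GLTriv⊢emb p) (GL⊢⇒GLTriv⊢emb q)
GL⊢⇒GLTriv⊢emb (nec p) = nec (GL⊢⇒GLTriv⊢emb p)

propositionA2 : (A : FmP) → ((GLTriv⊢ emb A → GL⊢ A) × (GL⊢ A → GLTriv⊢ emb A))
propositionA2 A = (λ p → subst GL⊢_ (erase-emb A) (GLTriv⊢⇒GL⊢erase p)) , GL⊢⇒GLTriv⊢emb
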